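{- For integers $0\le k\le n$ define $P(n,k)$ and $Q(n,k)$ by $P(n,0)=Q(n,0)=2^n-1$, $P(n,n)=Q(n,n)=2^{n-2}n(n-1)+2^n-1$ for $n\ge1$, and for $0<k<n$: $P(n,k)=P(n-1,k)+P(n-1,k-1)+k2^{k-1}+2^{n-1}$ and $Q(n,k)=Q(n-1,k)+Q(n-1,k-1)+k2^k-2^k+1+2^{n-1}$. Then for every $n\ge1$, with $N=2^n$, $$Q(n,n-1)-P(n,n-1)=N\frac{\log_2N-4}{2}+\log_2N+2.$$
   Context: $Q(n,k)$ is the number of comparators $|pw\_sel^N_K|$ of the Pairwise Selection Network and $P(n,k)$ the number $|pw\_hbit\_sel^N_K|$ of the Pairwise Half-Bitonic Selection Network selecting $K=2^k$ of $N=2^n$ inputs; the claim is $|pw\_sel^N_{N/2}|-|pw\_hbit\_sel^N_{N/2}|=N(\log N-4)/2+\log N+2$. -}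

module Defs where

open import Data.Nat using (ℕ; zero; suc; _+_; _*_; _∸_; _^_; _<ᵇ_)
open import Data.Bool using (if_then_else_)

-- Diagonal value for n ≥ 1: 2^(n-2) n (n-1) + 2^n - 1.
-- (For n = 1 the truncated exponent n ∸ 2 = 0 is harmless since n-1 = 0.)
diag : ℕ → ℕ
diag n = 2 ^ (n ∸ 2) * n * (n ∸ 1) + 2 ^ n ∸ 1

-- P n k and Q n k are meaningful for 0 ≤ k ≤ n; values for k > n are junk (0).
-- Case (suc n) (suc k): if k < n then 0 < k+1 < n+1 (recurrence), else k+1 = n+1 (diagonal).
P : ℕ → ℕ → ℕ
P n zero = 2 ^ n ∸ 1
P zero (suc k) = 0
P (suc n) (suc k) =
  if k <ᵇ n
  then P n (suc k) + P n k + suc k * 2 ^ k + 2 ^ n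
  else diag (suc n)

Q : ℕ → ℕ → ℕ
Q n zero = 2 ^ n ∸ 1
Q zero (suc k) = 0
Q (suc n) (suc k) =
  if k <ᵇ n
  then Q n (suc k) + Q n k + (suc k * 2 ^ suc k ∸ 2 ^ suc k + 1) + 2 ^ n
  else diag (suc n)

-- Both networks have the same diagonal value, so the diagonal cancels from the
-- recurrence at k = n - 1 and the gap D(n) = Q(n, n-1) - P(n, n-1) grows by the
-- difference of the two merging costs, (n-2) 2^(n-1) - (n-1) 2^(n-2) + 1
-- = (n-3) 2^(n-2) + 1. The claimed closed form has the same increment and agrees
-- with D(1) = 0, so induction on n finishes the proof.
module Submission where

open import Defs
open import Data.Bool using (true; false)
open import Data.Nat using (ℕ; zero; suc; _∸_; _^_; _<ᵇ_)
import Data.Nat as ℕ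
open import Data.Nat.Properties using (m+n∸m≡n)
open import Data.Integer using (ℤ; +_; _+_; _-_; _*_)
open import Data.Integer.Properties using (pos-+; pos-*)
open import Data.Integer.Tactic.RingSolver using (solve-∀)
open import Relation.Binary.PropositionalEquality
  using (_≡_; refl; cong; cong₂; sym; trans; module ≡-Reasoning)

n<ᵇ1+n : ∀ n → (n <ᵇ suc n) ≡ true
n<ᵇ1+n zero    = refl
n<ᵇ1+n (suc n) = n<ᵇ1+n n

n<ᵇn≡false : ∀ n → (n <ᵇ n) ≡ false
n<ᵇn≡false zero    = refl
n<ᵇn≡false (suc n) = n<ᵇn≡false n

P-subdiagonal : ∀ j → P (2 ℕ.+ j) (1 ℕ.+ j)
  ≡ diag (1 ℕ.+ j) ℕ.+ P (1 ℕ.+ j) j ℕ.+ (1 ℕ.+ j) ℕ.* 2 ^ j ℕ.+ 2 ^ (1 ℕ.+ j)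
P-subdiagonal j rewrite n<ᵇ1+n j | n<ᵇn≡false j = refl

Q-subdiagonal : ∀ j → Q (2 ℕ.+ j) (1 ℕ.+ j)
  ≡ diag (1 ℕ.+ j) ℕ.+ Q (1 ℕ.+ j) j ℕ.+ (j ℕ.* 2 ^ (1 ℕ.+ j) ℕ.+ 1) ℕ.+ 2 ^ (1 ℕ.+ j)
Q-subdiagonal j rewrite n<ᵇ1+n j | n<ᵇn≡false j
  | m+n∸m≡n (2 ^ (1 ℕ.+ j)) (j ℕ.* 2 ^ (1 ℕ.+ j)) = refl

pos-sub-cancel : ∀ d a b u v e →
  + (d ℕ.+ a ℕ.+ u ℕ.+ e) - + (d ℕ.+ b ℕ.+ v ℕ.+ e) ≡ (+ a - + b) + (+ u - + v)
pos-sub-cancel d a b u v e = begin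
  + (d ℕ.+ a ℕ.+ u ℕ.+ e) - + (d ℕ.+ b ℕ.+ v ℕ.+ e)
    ≡⟨ cong₂ _-_ (pos-+₄ d a u e) (pos-+₄ d b v e) ⟩
  (+ d + + a + + u + + e) - (+ d + + b + + v + + e)
    ≡⟨ sub-cancel (+ d) (+ a) (+ b) (+ u) (+ v) (+ e) ⟩
  (+ a - + b) + (+ u - + v) ∎
  where
  open ≡-Reasoning
  sub-cancel : ∀ D A B U V E → (D + A + U + E) - (D + B + V + E) ≡ (A - B) + (U - V)
  sub-cancel = solve-∀
  pos-+₄ : ∀ w x y z → + (w ℕ.+ x ℕ.+ y ℕ.+ z) ≡ + w + + x + + y + + z
  pos-+₄ w x y z = begin
    + (w ℕ.+ x ℕ.+ y ℕ.+ z)     ≡⟨ pos-+ (w ℕ.+ x ℕ.+ y) z ⟩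
    + (w ℕ.+ x ℕ.+ y) + + z     ≡⟨ cong (_+ + z) (pos-+ (w ℕ.+ x) y) ⟩
    + (w ℕ.+ x) + + y + + z     ≡⟨ cong (λ t → t + + y + + z) (pos-+ w x) ⟩
    + w + + x + + y + + z       ∎

gapIncrement : ℕ → ℤ
gapIncrement j = + (j ℕ.* 2 ^ (1 ℕ.+ j) ℕ.+ 1) - + ((1 ℕ.+ j) ℕ.* 2 ^ j)

gap : ℕ → ℤ
gap n = + Q n (n ∸ 1) - + P n (n ∸ 1)

gap-step : ∀ j → gap (2 ℕ.+ j) ≡ gap (1 ℕ.+ j) + gapIncrement j
gap-step j = begin
  gap (2 ℕ.+ j)
    ≡⟨ cong₂ _-_ (cong +_ (Q-subdiagonal j)) (cong +_ (P-subdiagonal j)) ⟩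
  _ ≡⟨ pos-sub-cancel (diag (1 ℕ.+ j)) (Q (1 ℕ.+ j) j) (P (1 ℕ.+ j) j) _ _ (2 ^ (1 ℕ.+ j)) ⟩
  gap (1 ℕ.+ j) + gapIncrement j ∎
  where open ≡-Reasoning

closedForm : ℕ → ℤ
closedForm n = + (2 ^ (n ∸ 1)) * (+ n - + 4) + + n + + 2

closedForm-step : ∀ j → closedForm (2 ℕ.+ j) ≡ closedForm (1 ℕ.+ j) + gapIncrement j
closedForm-step j = begin
  closedForm (2 ℕ.+ j)
    ≡⟨ cong (λ t → t * (+ (2 ℕ.+ j) - + 4) + + (2 ℕ.+ j) + + 2) (pos-* 2 X) ⟩
  + 2 * + X * (+ 2 + + j - + 4) + (+ 2 + + j) + + 2
    ≡⟨ closedForm-difference (+ j) (+ X) ⟩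
  closedForm (1 ℕ.+ j) + ((+ j * (+ 2 * + X) + + 1) - (+ 1 + + j) * + X)
    ≡⟨ cong (λ t → closedForm (1 ℕ.+ j) + t) (sym (cong₂ _-_ increment₁ increment₂)) ⟩
  closedForm (1 ℕ.+ j) + gapIncrement j ∎
  where
  open ≡-Reasoning
  X = 2 ^ j
  closedForm-difference : ∀ J Y → + 2 * Y * (+ 2 + J - + 4) + (+ 2 + J) + + 2
    ≡ (Y * (+ 1 + J - + 4) + (+ 1 + J) + + 2) + ((J * (+ 2 * Y) + + 1) - (+ 1 + J) * Y)
  closedForm-difference = solve-∀
  increment₁ : + (j ℕ.* (2 ℕ.* X) ℕ.+ 1) ≡ + j * (+ 2 * + X) + + 1
  increment₁ = trans (pos-+ (j ℕ.* (2 ℕ.* X)) 1)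
    (cong (_+ + 1) (trans (pos-* j (2 ℕ.* X)) (cong (+ j *_) (pos-* 2 X))))
  increment₂ : + ((1 ℕ.+ j) ℕ.* X) ≡ (+ 1 + + j) * + X
  increment₂ = pos-* (1 ℕ.+ j) X

gap≡closedForm : ∀ m → gap (suc m) ≡ closedForm (suc m)
gap≡closedForm zero    = refl
gap≡closedForm (suc j) = begin
  gap (2 ℕ.+ j)                          ≡⟨ gap-step j ⟩
  gap (1 ℕ.+ j) + gapIncrement j         ≡⟨ cong (_+ gapIncrement j) (gap≡closedForm j) ⟩
  closedForm (1 ℕ.+ j) + gapIncrement j  ≡⟨ sym (closedForm-step j) ⟩
  closedForm (2 ℕ.+ j)                   ∎
  where open ≡-Reasoning

mainTheorem15 : ∀ (m : ℕ) → let n = suc m in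
    + Q n (n ∸ 1) - + P n (n ∸ 1) ≡ + (2 ^ (n ∸ 1)) * (+ n - + 4) + + n + + 2
mainTheorem15 = gap≡closedForm
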